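{- For any two permutations $\sigma,\tau$ of $\{1,2,3,4\}$ there exists a matrix $B\in\mathcal{PC}_4$ such that the right Perron eigenvector $x$ of $B$ satisfies $x_{\sigma(1)}<x_{\sigma(2)}<x_{\sigma(3)}<x_{\sigma(4)}$ and the entrywise inverse $y$ of the left Perron eigenvector $z$ of $B$ (i.e. $y_i=1/z_i$) satisfies $y_{\tau(1)}<y_{\tau(2)}<y_{\tau(3)}<y_{\tau(4)}$. In particular, there exists $B\in\mathcal{PC}_4$ whose right Perron eigenvector and entrywise inverse left Perron eigenvector have strictly reverse orders.
   Context: $\mathcal{PC}_n$ denotes the set of $n$-by-$n$ reciprocal (pairwise comparison) matrices: entrywise positive matrices $A=[a_{ij}]$ with $a_{ji}=1/a_{ij}$ for all $1\le i,j\le n$. For an entrywise positive matrix, the right (resp. left) Perron eigenvector is the entrywise positive eigenvector of the matrix (resp. of its transpose) associated with the Perron root; it is unique up to positive scaling, so strict orderings of its entries are well defined. -}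

module Defs where

open import Level using (0ℓ)
open import Data.Nat using (ℕ; zero; suc)
open import Data.Fin using (Fin; zero; suc)
open import Data.Product using (Σ; _×_; _,_; ∃; ∃-syntax)
open import Data.Sum using (_⊎_)
open import Relation.Binary.PropositionalEquality using (_≡_; _≢_)
open import Relation.Nullary using (¬_)
open import Algebra.Structures using (IsCommutativeRing)
open import Relation.Binary.Structures using (IsStrictTotalOrder)
open import Data.Fin.Permutation using (Permutation′; _⟨$⟩ʳ_)

-- An axiomatisation of the real numbers: a Dedekind-complete ordered field.
-- (Any two models are isomorphic, so quantifying over all models is
-- the same as speaking about ℝ.)
record CompleteOrderedField : Set₁ where
  infixl 6 _+_
  infixl 7 _*_
  infix 4 _<_
  field
    Carrier : Set
    _+_ _*_ : Carrier → Carrier → Carrier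
    -_ : Carrier → Carrier
    0# 1# : Carrier
    _⁻¹ : Carrier → Carrier
    _<_ : Carrier → Carrier → Set
    isCommutativeRing : IsCommutativeRing _≡_ _+_ _*_ -_ 0# 1#
    0≢1 : 0# ≢ 1#
    ⁻¹-inverse : ∀ x → x ≢ 0# → x * (x ⁻¹) ≡ 1#
    isStrictTotalOrder : IsStrictTotalOrder _≡_ _<_
    +-mono-< : ∀ {a b} c → a < b → a + c < b + c
    *-pos : ∀ {a b} → 0# < a → 0# < b → 0# < a * b
    complete : (P : Carrier → Set) → (∃[ x ] P x) →
               (∃[ u ] (∀ x → P x → ¬ (u < x))) →
               ∃[ s ] ((∀ x → P x → ¬ (s < x)) ×
                       (∀ u → (∀ x → P x → ¬ (u < x)) → ¬ (u < s)))

module _ (R : CompleteOrderedField) where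
  open CompleteOrderedField R

  Matrix : ℕ → Set
  Matrix n = Fin n → Fin n → Carrier

  Vector : ℕ → Set
  Vector n = Fin n → Carrier

  Σ' : (n : ℕ) → (Fin n → Carrier) → Carrier
  Σ' zero f = 0#
  Σ' (suc n) f = f zero + Σ' n (λ i → f (suc i))

  IsPC : (n : ℕ) → Matrix n → Set
  IsPC n A = (∀ i j → 0# < A i j) × (∀ i j → A j i ≡ (A i j) ⁻¹)

  mulV : (n : ℕ) → Matrix n → Vector n → Vector n
  mulV n A x i = Σ' n (λ j → A i j * x j)

  transpose : (n : ℕ) → Matrix n → Matrix n
  transpose n A i j = A j i

  _² : Carrier → Carrier
  a ² = a * a

  -- (a + i b) is a complex eigenvalue of the real matrix A, with complex
  -- eigenvector u + i v ≠ 0:  A(u + iv) = (a + ib)(u + iv).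
  IsComplexEigenvalue : (n : ℕ) → Matrix n → Carrier → Carrier → Set
  IsComplexEigenvalue n A a b =
    ∃[ u ] ∃[ v ] ((∃[ k ] (u k ≢ 0# ⊎ v k ≢ 0#)) ×
      (∀ i → mulV n A u i ≡ a * u i + - (b * v i)) ×
      (∀ i → mulV n A v i ≡ b * u i + a * v i))

  -- Perron root: the spectral radius, which (for positive matrices) is an
  -- eigenvalue; stated as: ρ ≥ 0, ρ is an eigenvalue, and every complex
  -- eigenvalue μ satisfies |μ| ≤ ρ.
  IsPerronRoot : (n : ℕ) → Matrix n → Carrier → Set
  IsPerronRoot n A ρ =
    ¬ (ρ < 0#) × IsComplexEigenvalue n A ρ 0# ×
    (∀ a b → IsComplexEigenvalue n A a b → ¬ (ρ ² < a ² + b ²))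

  IsRightPerronVector : (n : ℕ) → Matrix n → Vector n → Set
  IsRightPerronVector n A x =
    ∃[ ρ ] (IsPerronRoot n A ρ × (∀ i → 0# < x i) ×
            (∀ i → mulV n A x i ≡ ρ * x i))

  IsLeftPerronVector : (n : ℕ) → Matrix n → Vector n → Set
  IsLeftPerronVector n A z = IsRightPerronVector n (transpose n A) z

  IncreasingAlong4 : Permutation′ 4 → Vector 4 → Set
  IncreasingAlong4 σ x =
    (x (σ ⟨$⟩ʳ zero) < x (σ ⟨$⟩ʳ suc zero)) ×
    (x (σ ⟨$⟩ʳ suc zero) < x (σ ⟨$⟩ʳ suc (suc zero))) ×
    (x (σ ⟨$⟩ʳ suc (suc zero)) < x (σ ⟨$⟩ʳ suc (suc (suc zero))))

  invV : (n : ℕ) → Vector n → Vector n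
  invV n z i = (z i) ⁻¹

  StrictlyReverse : (n : ℕ) → Vector n → Vector n → Set
  StrictlyReverse n x y = ∀ i j → i ≢ j →
    ((x i < x j) × (y j < y i)) ⊎ ((x j < x i) × (y i < y j))

-- A positive reciprocal matrix C with constant row sums ρ has right Perron vector 𝟙, and there
-- is a 4×4 such C whose left Perron vector w has consecutive entries growing by a factor larger
-- than 103/100. For any y with entries in [100, 103], the diagonal similarity
-- B = D C D⁻¹ with D = diag (w ∘ y) is again reciprocal, with right Perron vector x = w ∘ y and
-- left Perron vector z = 1/y. So x is ordered like w, while 1/z = y is arbitrary: relabelling C
-- by σ⁻¹ makes x increase along σ, and y is chosen to increase along τ. Reverse orders are the
-- case σ = id, τ = reverse.
--
-- The eigenvalue ρ of a positive eigenvector x of a positive matrix A is its Perron root: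
-- D⁻¹ A D (D = diag x) is positive with row sums ρ, so if u + iv is an eigenvector for a + ib,
-- Cauchy–Schwarz in the row i maximising q = (u² + v²)/x² gives (a² + b²) qᵢ ≤ ρ² qᵢ.

module Submission where

open import Defs
open import Level using (0ℓ)
open import Data.Nat as ℕ using (ℕ; zero; suc)
import Data.Nat.Properties as ℕ
open import Data.Fin as Fin using (Fin; zero; suc; toℕ)
import Data.Fin.Properties as Fin
open import Data.Fin.Patterns using (0F; 1F; 2F; 3F)
open import Data.Vec using (Vec; []; _∷_; lookup)
open import Data.Fin.Permutation as Permutation using (Permutation′; _⟨$⟩ʳ_; _⟨$⟩ˡ_)
open import Data.Product using (_×_; _,_; ∃-syntax; proj₁; proj₂)
open import Data.Sum using (_⊎_; inj₁; inj₂)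
open import Data.Empty using (⊥-elim)
open import Function using (_∘_)
open import Relation.Nullary using (¬_)
open import Relation.Binary.PropositionalEquality
  using (_≡_; _≢_; refl; sym; trans; cong; cong₂; subst₂; module ≡-Reasoning)
open import Relation.Binary.Core using (Rel)
open import Relation.Binary.Definitions using (Transitive; tri<; tri≈; tri>)
open import Relation.Binary.Bundles using (StrictTotalOrder)
open import Algebra.Bundles using (CommutativeRing)
import Algebra.Properties.Ring as RingProperties
import Algebra.Properties.Semiring.Mult as SemiringMultiplication
import Algebra.Solver.Ring.NaturalCoefficients.Default as NaturalCoefficientsSolver
import Relation.Binary.Construct.StrictToNonStrict as StrictToNonStrict
import Relation.Binary.Reasoning.StrictPartialOrder as StrictPartialOrderReasoning
import Algebra.Properties.CommutativeMonoid.Sum as CommutativeMonoidSum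

open CommutativeMonoidSum ℕ.+-0-commutativeMonoid using () renaming (sum to sumℕ)

module OrderedField (R : CompleteOrderedField) where
  open CompleteOrderedField R public

  commutativeRing : CommutativeRing 0ℓ 0ℓ
  commutativeRing = record { isCommutativeRing = isCommutativeRing }

  open CommutativeRing commutativeRing public
    using (+-assoc; +-comm; +-identityˡ; +-identityʳ; -‿inverseˡ; -‿inverseʳ;
           *-assoc; *-comm; *-identityˡ; *-identityʳ; distribˡ; zeroˡ; zeroʳ;
           semiring; commutativeSemiring)
  open RingProperties (CommutativeRing.ring commutativeRing) public
    using (-‿distribˡ-*; -‿distribʳ-*; -‿involutive; -0#≈0#)
  open NaturalCoefficientsSolver commutativeSemiring public
    using (solve; _:=_; _:+_; _:*_; con)
  open SemiringMultiplication semiring public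
    using (×-homo-+; ×1-homo-*) renaming (_×_ to _×ᵤ_)

  strictTotalOrder : StrictTotalOrder 0ℓ 0ℓ 0ℓ
  strictTotalOrder = record { isStrictTotalOrder = isStrictTotalOrder }

  open StrictTotalOrder strictTotalOrder public
    using (compare; irrefl; asym) renaming (trans to <-trans)

  infix 4 _≤_
  _≤_ : Carrier → Carrier → Set
  _≤_ = StrictToNonStrict._≤_ _≡_ _<_

  module ≤-Reasoning = StrictPartialOrderReasoning (StrictTotalOrder.strictPartialOrder strictTotalOrder)

  <⇒≤ : ∀ {a b} → a < b → a ≤ b
  <⇒≤ = inj₁

  ≤-refl : ∀ {a} → a ≤ a
  ≤-refl = inj₂ refl

  ≤⇒≯ : ∀ {a b} → a ≤ b → ¬ (b < a)
  ≤⇒≯ (inj₁ a<b) b<a = asym a<b b<a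
  ≤⇒≯ (inj₂ refl) a<a = irrefl refl a<a

  ≤-trans : ∀ {a b c} → a ≤ b → b ≤ c → a ≤ c
  ≤-trans (inj₁ a<b) (inj₁ b<c) = inj₁ (<-trans a<b b<c)
  ≤-trans (inj₁ a<b) (inj₂ refl) = inj₁ a<b
  ≤-trans (inj₂ refl) b≤c = b≤c

  <-≤-trans : ∀ {a b c} → a < b → b ≤ c → a < c
  <-≤-trans a<b (inj₁ b<c) = <-trans a<b b<c
  <-≤-trans a<b (inj₂ refl) = a<b

  +-monoʳ-< : ∀ {a b} c → a < b → c + a < c + b
  +-monoʳ-< {a} {b} c a<b = subst₂ _<_ (+-comm a c) (+-comm b c) (+-mono-< c a<b)

  +-mono-≤ : ∀ {a b c d} → a ≤ b → c ≤ d → a + c ≤ b + d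
  +-mono-≤ (inj₁ a<b) (inj₁ c<d) = inj₁ (<-trans (+-mono-< _ a<b) (+-monoʳ-< _ c<d))
  +-mono-≤ (inj₁ a<b) (inj₂ refl) = inj₁ (+-mono-< _ a<b)
  +-mono-≤ (inj₂ refl) (inj₁ c<d) = inj₁ (+-monoʳ-< _ c<d)
  +-mono-≤ (inj₂ refl) (inj₂ refl) = ≤-refl

  +-mono-<-≤ : ∀ {a b c d} → a < b → c ≤ d → a + c < b + d
  +-mono-<-≤ a<b (inj₁ c<d) = <-trans (+-mono-< _ a<b) (+-monoʳ-< _ c<d)
  +-mono-<-≤ a<b (inj₂ refl) = +-mono-< _ a<b

  +-monoʳ-≤ : ∀ {a b} c → a ≤ b → c + a ≤ c + b
  +-monoʳ-≤ c = +-mono-≤ (≤-refl {c})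

  x<y⇒0<y-x : ∀ {x y} → x < y → 0# < y + - x
  x<y⇒0<y-x {x} {y} x<y = subst₂ _<_ (-‿inverseʳ x) refl (+-mono-< (- x) x<y)

  0<y-x⇒x<y : ∀ {x y} → 0# < y + - x → x < y
  0<y-x⇒x<y {x} {y} 0<y-x = subst₂ _<_ (+-identityˡ x) y-x+x≡y (+-mono-< x 0<y-x)
    where
    y-x+x≡y : y + - x + x ≡ y
    y-x+x≡y = trans (+-assoc y (- x) x) (trans (cong (y +_) (-‿inverseˡ x)) (+-identityʳ y))

  0≤y-x⇒x≤y : ∀ {x y} → 0# ≤ y + - x → x ≤ y
  0≤y-x⇒x≤y (inj₁ 0<y-x) = inj₁ (0<y-x⇒x<y 0<y-x)
  0≤y-x⇒x≤y {x} {y} (inj₂ 0≡y-x) = inj₂ (begin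
    x                ≡⟨ +-identityˡ x ⟨
    0# + x           ≡⟨ cong (_+ x) 0≡y-x ⟩
    y + - x + x      ≡⟨ +-assoc y (- x) x ⟩
    y + (- x + x)    ≡⟨ cong (y +_) (-‿inverseˡ x) ⟩
    y + 0#           ≡⟨ +-identityʳ y ⟩
    y                ∎)
    where open ≡-Reasoning

  *-monoˡ-< : ∀ {c a b} → 0# < c → a < b → c * a < c * b
  *-monoˡ-< {c} {a} {b} 0<c a<b = 0<y-x⇒x<y (subst₂ _<_ refl c[b-a]≡cb-ca (*-pos 0<c (x<y⇒0<y-x a<b)))
    where
    c[b-a]≡cb-ca : c * (b + - a) ≡ c * b + - (c * a)
    c[b-a]≡cb-ca = trans (distribˡ c b (- a)) (cong (c * b +_) (sym (-‿distribʳ-* c a)))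

  *-monoˡ-≤ : ∀ {c a b} → 0# ≤ c → a ≤ b → c * a ≤ c * b
  *-monoˡ-≤ (inj₁ 0<c) (inj₁ a<b) = inj₁ (*-monoˡ-< 0<c a<b)
  *-monoˡ-≤ {a = a} {b} (inj₂ refl) _ = inj₂ (trans (zeroˡ a) (sym (zeroˡ b)))
  *-monoˡ-≤ (inj₁ _) (inj₂ refl) = ≤-refl

  neg-pos : ∀ {x} → x < 0# → 0# < - x
  neg-pos {x} x<0 = subst₂ _<_ (-‿inverseʳ x) (+-identityˡ (- x)) (+-mono-< (- x) x<0)

  neg*neg : ∀ x y → - x * - y ≡ x * y
  neg*neg x y = begin
    - x * - y     ≡⟨ -‿distribˡ-* x (- y) ⟨
    - (x * - y)   ≡⟨ cong -_ (-‿distribʳ-* x y) ⟨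
    - - (x * y)   ≡⟨ -‿involutive (x * y) ⟩
    x * y         ∎
    where open ≡-Reasoning

  square-pos : ∀ {x} → x ≢ 0# → 0# < x * x
  square-pos {x} x≢0 with compare x 0#
  ... | tri< x<0 _ _ = subst₂ _<_ refl (neg*neg x x) (*-pos (neg-pos x<0) (neg-pos x<0))
  ... | tri≈ _ x≡0 _ = ⊥-elim (x≢0 x≡0)
  ... | tri> _ _ 0<x = *-pos 0<x 0<x

  square-nonneg : ∀ x → 0# ≤ x * x
  square-nonneg x with compare x 0#
  ... | tri≈ _ refl _ = inj₂ (sym (zeroˡ 0#))
  ... | tri< _ x≢0 _ = inj₁ (square-pos x≢0)
  ... | tri> _ x≢0 _ = inj₁ (square-pos x≢0)

  mul-≢0 : ∀ {a b} → a ≢ 0# → b ≢ 0# → a * b ≢ 0#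
  mul-≢0 {a} {b} a≢0 b≢0 ab≡0 = a≢0 (begin
    a                ≡⟨ *-identityʳ a ⟨
    a * 1#           ≡⟨ cong (a *_) (⁻¹-inverse b b≢0) ⟨
    a * (b * b ⁻¹)   ≡⟨ *-assoc a b (b ⁻¹) ⟨
    a * b * b ⁻¹     ≡⟨ cong (_* b ⁻¹) ab≡0 ⟩
    0# * b ⁻¹        ≡⟨ zeroˡ (b ⁻¹) ⟩
    0#               ∎)
    where open ≡-Reasoning

  0<1 : 0# < 1#
  0<1 with compare 0# 1#
  ... | tri< 0<1 _ _ = 0<1
  ... | tri≈ _ 0≡1 _ = ⊥-elim (0≢1 0≡1)
  ... | tri> _ _ 1<0 = ⊥-elim (asym 1<0 (subst₂ _<_ refl -1*-1≡1 (*-pos 0<-1 0<-1)))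
    where
    0<-1 = neg-pos 1<0
    -1*-1≡1 = trans (neg*neg 1# 1#) (*-identityˡ 1#)

  pos⇒≢0 : ∀ {a} → 0# < a → a ≢ 0#
  pos⇒≢0 0<a refl = irrefl refl 0<a

  ⁻¹-inverseˡ : ∀ {a} → 0# < a → a ⁻¹ * a ≡ 1#
  ⁻¹-inverseˡ {a} 0<a = trans (*-comm (a ⁻¹) a) (⁻¹-inverse a (pos⇒≢0 0<a))

  ⁻¹-inverseʳ : ∀ {a} → 0# < a → a * a ⁻¹ ≡ 1#
  ⁻¹-inverseʳ {a} 0<a = ⁻¹-inverse a (pos⇒≢0 0<a)

  ⁻¹-unique : ∀ {a} b → 0# < a → a * b ≡ 1# → b ≡ a ⁻¹
  ⁻¹-unique {a} b 0<a ab≡1 = begin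
    b                ≡⟨ *-identityˡ b ⟨
    1# * b           ≡⟨ cong (_* b) (⁻¹-inverseˡ 0<a) ⟨
    a ⁻¹ * a * b     ≡⟨ *-assoc (a ⁻¹) a b ⟩
    a ⁻¹ * (a * b)   ≡⟨ cong (a ⁻¹ *_) ab≡1 ⟩
    a ⁻¹ * 1#        ≡⟨ *-identityʳ (a ⁻¹) ⟩
    a ⁻¹             ∎
    where open ≡-Reasoning

  ⁻¹-pos : ∀ {a} → 0# < a → 0# < a ⁻¹
  ⁻¹-pos {a} 0<a with compare 0# (a ⁻¹)
  ... | tri< 0<a⁻¹ _ _ = 0<a⁻¹
  ... | tri≈ _ 0≡a⁻¹ _ = ⊥-elim (0≢1 (trans (sym (zeroʳ a)) (trans (cong (a *_) 0≡a⁻¹) (⁻¹-inverseʳ 0<a))))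
  ... | tri> _ _ a⁻¹<0 = ⊥-elim (asym 0<1 (subst₂ _<_ (⁻¹-inverseʳ 0<a) (zeroʳ a) (*-monoˡ-< 0<a a⁻¹<0)))

  ⁻¹-involutive : ∀ {a} → 0# < a → a ⁻¹ ⁻¹ ≡ a
  ⁻¹-involutive 0<a = sym (⁻¹-unique _ (⁻¹-pos 0<a) (⁻¹-inverseˡ 0<a))

  ⁻¹-distrib-* : ∀ {a b} → 0# < a → 0# < b → (a * b) ⁻¹ ≡ a ⁻¹ * b ⁻¹
  ⁻¹-distrib-* {a} {b} 0<a 0<b = sym (⁻¹-unique _ (*-pos 0<a 0<b) (begin
    a * b * (a ⁻¹ * b ⁻¹)
      ≡⟨ solve 4 (λ a b a' b' → a :* b :* (a' :* b') := (a :* a') :* (b :* b')) refl a b (a ⁻¹) (b ⁻¹) ⟩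
    (a * a ⁻¹) * (b * b ⁻¹)      ≡⟨ cong₂ _*_ (⁻¹-inverseʳ 0<a) (⁻¹-inverseʳ 0<b) ⟩
    1# * 1#                      ≡⟨ *-identityˡ 1# ⟩
    1#                           ∎))
    where open ≡-Reasoning

  fromℕ : ℕ → Carrier
  fromℕ n = n ×ᵤ 1#

  fromℕ-<-suc : ∀ n → fromℕ n < fromℕ (suc n)
  fromℕ-<-suc n = subst₂ _<_ (+-identityˡ (fromℕ n)) refl (+-mono-< (fromℕ n) 0<1)

  fromℕ-< : ∀ {m n} → m ℕ.< n → fromℕ m < fromℕ n
  fromℕ-< {m} {suc n} (ℕ.s≤s m≤n) with ℕ.m≤n⇒m<n∨m≡n m≤n
  ... | inj₁ m<n = <-trans (fromℕ-< m<n) (fromℕ-<-suc n)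
  ... | inj₂ refl = fromℕ-<-suc n

module FiniteSums (R : CompleteOrderedField) where
  open OrderedField R
  open CommutativeMonoidSum (CommutativeRing.+-commutativeMonoid commutativeRing) using (sum; sum-permute)

  Σ'-cong : ∀ n {f g : Fin n → Carrier} → (∀ i → f i ≡ g i) → Σ' R n f ≡ Σ' R n g
  Σ'-cong zero f≗g = refl
  Σ'-cong (suc n) f≗g = cong₂ _+_ (f≗g zero) (Σ'-cong n (f≗g ∘ suc))

  *-distribˡ-Σ' : ∀ n c (f : Fin n → Carrier) → c * Σ' R n f ≡ Σ' R n (λ j → c * f j)
  *-distribˡ-Σ' zero c f = zeroʳ c
  *-distribˡ-Σ' (suc n) c f = trans (distribˡ c (f zero) _) (cong (c * f zero +_) (*-distribˡ-Σ' n c (f ∘ suc)))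

  Σ'-distrib-+ : ∀ n (f g : Fin n → Carrier) → Σ' R n (λ j → f j + g j) ≡ Σ' R n f + Σ' R n g
  Σ'-distrib-+ zero f g = sym (+-identityˡ 0#)
  Σ'-distrib-+ (suc n) f g = begin
    f zero + g zero + Σ' R n (λ j → f (suc j) + g (suc j))
      ≡⟨ cong (f zero + g zero +_) (Σ'-distrib-+ n (f ∘ suc) (g ∘ suc)) ⟩
    f zero + g zero + (Σ' R n (f ∘ suc) + Σ' R n (g ∘ suc))
      ≡⟨ solve 4 (λ a b s t → a :+ b :+ (s :+ t) := a :+ s :+ (b :+ t)) refl (f zero) (g zero) _ _ ⟩
    f zero + Σ' R n (f ∘ suc) + (g zero + Σ' R n (g ∘ suc))  ∎
    where open ≡-Reasoning

  Σ'-mono-≤ : ∀ n {f g : Fin n → Carrier} → (∀ i → f i ≤ g i) → Σ' R n f ≤ Σ' R n g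
  Σ'-mono-≤ zero f≤g = ≤-refl
  Σ'-mono-≤ (suc n) f≤g = +-mono-≤ (f≤g zero) (Σ'-mono-≤ n (f≤g ∘ suc))

  Σ'-nonneg : ∀ n {f : Fin n → Carrier} → (∀ i → 0# ≤ f i) → 0# ≤ Σ' R n f
  Σ'-nonneg zero 0≤f = ≤-refl
  Σ'-nonneg (suc n) 0≤f = subst₂ _≤_ (+-identityˡ 0#) refl (+-mono-≤ (0≤f zero) (Σ'-nonneg n (0≤f ∘ suc)))

  Σ'-pos : ∀ n {f : Fin (suc n) → Carrier} → (∀ i → 0# < f i) → 0# < Σ' R (suc n) f
  Σ'-pos n 0<f = subst₂ _<_ (+-identityˡ 0#) refl (+-mono-<-≤ (0<f zero) (Σ'-nonneg n (<⇒≤ ∘ 0<f ∘ suc)))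

  Σ'≡sum : ∀ n (f : Fin n → Carrier) → Σ' R n f ≡ sum f
  Σ'≡sum zero f = refl
  Σ'≡sum (suc n) f = cong (f zero +_) (Σ'≡sum n (f ∘ suc))

  Σ'-permute : ∀ {n} (f : Fin n → Carrier) (π : Permutation′ n) → Σ' R n f ≡ Σ' R n (f ∘ (π ⟨$⟩ʳ_))
  Σ'-permute {n} f π = begin
    Σ' R n f                 ≡⟨ Σ'≡sum n f ⟩
    sum f                    ≡⟨ sum-permute f π ⟩
    sum (f ∘ (π ⟨$⟩ʳ_))      ≡⟨ Σ'≡sum n (f ∘ (π ⟨$⟩ʳ_)) ⟨
    Σ' R n (f ∘ (π ⟨$⟩ʳ_))   ∎
    where open ≡-Reasoning

  Σ'-fromℕ : ∀ n (f : Fin n → ℕ) → Σ' R n (fromℕ ∘ f) ≡ fromℕ (sumℕ f)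
  Σ'-fromℕ zero f = refl
  Σ'-fromℕ (suc n) f =
    trans (cong (fromℕ (f zero) +_) (Σ'-fromℕ n (f ∘ suc))) (sym (×-homo-+ 1# (f zero) (sumℕ (f ∘ suc))))

module Eigenvectors (R : CompleteOrderedField) where
  open OrderedField R
  open FiniteSums R

  IsEigenvector : (n : ℕ) → Matrix R n → Carrier → Vector R n → Set
  IsEigenvector n A ρ x = ∀ i → mulV R n A x i ≡ ρ * x i

  permute : ∀ {n} → Permutation′ n → Matrix R n → Matrix R n
  permute π A i j = A (π ⟨$⟩ʳ i) (π ⟨$⟩ʳ j)

  permute-pc : ∀ {n} (π : Permutation′ n) {A} → IsPC R n A → IsPC R n (permute π A)
  permute-pc π (A-pos , A-reciprocal) =
    (λ i j → A-pos (π ⟨$⟩ʳ i) (π ⟨$⟩ʳ j)) , (λ i j → A-reciprocal (π ⟨$⟩ʳ i) (π ⟨$⟩ʳ j))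

  permute-rowSum : ∀ {n} (π : Permutation′ n) (A : Matrix R n) i → Σ' R n (permute π A i) ≡ Σ' R n (A (π ⟨$⟩ʳ i))
  permute-rowSum π A i = sym (Σ'-permute (A (π ⟨$⟩ʳ i)) π)

  permute-eigenvector : ∀ {n} (π : Permutation′ n) {A ρ x} →
    IsEigenvector n A ρ x → IsEigenvector n (permute π A) ρ (x ∘ (π ⟨$⟩ʳ_))
  permute-eigenvector π {A} {x = x} Ax≡ρx i =
    trans (sym (Σ'-permute (λ j → A (π ⟨$⟩ʳ i) j * x j) π)) (Ax≡ρx (π ⟨$⟩ʳ i))

module CauchySchwarz (R : CompleteOrderedField) where
  open OrderedField R
  open FiniteSums R

  2xy≤x²+y² : ∀ x y → (1# + 1#) * (x * y) ≤ x * x + y * y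
  2xy≤x²+y² x y = 0≤y-x⇒x≤y (subst₂ _≤_ refl [x-y]²≡x²+y²-2xy (square-nonneg (x + - y)))
    where
    open ≡-Reasoning
    [x-y]²≡x²+y²-2xy : (x + - y) * (x + - y) ≡ x * x + y * y + - ((1# + 1#) * (x * y))
    [x-y]²≡x²+y²-2xy = begin
      (x + - y) * (x + - y)
        ≡⟨ solve 2 (λ x n → (x :+ n) :* (x :+ n) := x :* x :+ n :* n :+ con 2 :* (x :* n)) refl x (- y) ⟩
      x * x + - y * - y + (1# + 1#) * (x * - y)
        ≡⟨ cong₂ (λ s t → x * x + s + (1# + 1#) * t) (neg*neg y y) (sym (-‿distribʳ-* x y)) ⟩
      x * x + y * y + (1# + 1#) * - (x * y)
        ≡⟨ cong (x * x + y * y +_) (-‿distribʳ-* (1# + 1#) (x * y)) ⟨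
      x * x + y * y + - ((1# + 1#) * (x * y))  ∎

  Σ'-2xy≤x²+y² : ∀ n (c u : Fin n → Carrier) t → (∀ j → 0# ≤ c j) →
    (1# + 1#) * (t * Σ' R n (λ j → c j * u j)) ≤ Σ' R n (λ j → c j * (u j * u j)) + t * t * Σ' R n c
  Σ'-2xy≤x²+y² zero c u t _ = inj₂ (solve 1 (λ t → con 2 :* (t :* con 0) := con 0 :+ t :* t :* con 0) refl t)
  Σ'-2xy≤x²+y² (suc n) c u t 0≤c = begin
    (1# + 1#) * (t * (c₀ * u₀ + T))
      ≡⟨ solve 4 (λ t c₀ u₀ T → con 2 :* (t :* (c₀ :* u₀ :+ T)) := c₀ :* (con 2 :* (t :* u₀)) :+ con 2 :* (t :* T))
               refl t c₀ u₀ T ⟩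
    c₀ * ((1# + 1#) * (t * u₀)) + (1# + 1#) * (t * T)
      ≤⟨ +-mono-≤ (*-monoˡ-≤ (0≤c zero) (2xy≤x²+y² t u₀))
                  (Σ'-2xy≤x²+y² n (c ∘ suc) (u ∘ suc) t (0≤c ∘ suc)) ⟩
    c₀ * (t * t + u₀ * u₀) + (Q + t * t * S)
      ≡⟨ solve 5 (λ t c₀ u₀ Q S → c₀ :* (t :* t :+ u₀ :* u₀) :+ (Q :+ t :* t :* S)
                               := c₀ :* (u₀ :* u₀) :+ Q :+ t :* t :* (c₀ :+ S))
               refl t c₀ u₀ Q S ⟩
    c₀ * (u₀ * u₀) + Q + t * t * (c₀ + S)  ∎
    where
    open ≤-Reasoning
    c₀ = c zero
    u₀ = u zero
    S = Σ' R n (c ∘ suc)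
    T = Σ' R n (λ j → c (suc j) * u (suc j))
    Q = Σ' R n (λ j → c (suc j) * (u (suc j) * u (suc j)))

  -- Adding a term (c₀, u₀) to S = Σ c, T = Σ c u, Q = Σ c u² increases S Q − T² by
  -- c₀ (Q − 2 u₀ T + u₀² S) = c₀ Σ c (u − u₀)², which is nonnegative by Σ'-2xy≤x²+y².
  cauchy-schwarz : ∀ n (c u : Fin n → Carrier) → (∀ j → 0# ≤ c j) →
    Σ' R n (λ j → c j * u j) * Σ' R n (λ j → c j * u j) ≤ Σ' R n c * Σ' R n (λ j → c j * (u j * u j))
  cauchy-schwarz zero c u _ = inj₂ (trans (zeroˡ 0#) (sym (zeroˡ 0#)))
  cauchy-schwarz (suc n) c u 0≤c = begin
    (c₀ * u₀ + T) * (c₀ * u₀ + T)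
      ≡⟨ solve 3 (λ c₀ u₀ T → (c₀ :* u₀ :+ T) :* (c₀ :* u₀ :+ T)
                           := c₀ :* (c₀ :* (u₀ :* u₀)) :+ c₀ :* (con 2 :* (u₀ :* T)) :+ T :* T)
               refl c₀ u₀ T ⟩
    c₀ * (c₀ * (u₀ * u₀)) + c₀ * ((1# + 1#) * (u₀ * T)) + T * T
      ≤⟨ +-mono-≤ (+-monoʳ-≤ _ (*-monoˡ-≤ (0≤c zero) (Σ'-2xy≤x²+y² n (c ∘ suc) (u ∘ suc) u₀ (0≤c ∘ suc))))
                  (cauchy-schwarz n (c ∘ suc) (u ∘ suc) (0≤c ∘ suc)) ⟩
    c₀ * (c₀ * (u₀ * u₀)) + c₀ * (Q + u₀ * u₀ * S) + S * Q
      ≡⟨ solve 4 (λ c₀ u₀ Q S → c₀ :* (c₀ :* (u₀ :* u₀)) :+ c₀ :* (Q :+ u₀ :* u₀ :* S) :+ S :* Q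
                             := (c₀ :+ S) :* (c₀ :* (u₀ :* u₀) :+ Q))
               refl c₀ u₀ Q S ⟩
    (c₀ + S) * (c₀ * (u₀ * u₀) + Q)  ∎
    where
    open ≤-Reasoning
    c₀ = c zero
    u₀ = u zero
    S = Σ' R n (c ∘ suc)
    T = Σ' R n (λ j → c (suc j) * u (suc j))
    Q = Σ' R n (λ j → c (suc j) * (u (suc j) * u (suc j)))

module PerronRoot (R : CompleteOrderedField) where
  open OrderedField R
  open FiniteSums R
  open Eigenvectors R
  open CauchySchwarz R

  argmax : ∀ n (f : Fin (suc n) → Carrier) → ∃[ i ] (∀ j → f j ≤ f i)
  argmax zero f = zero , λ { zero → ≤-refl }
  argmax (suc n) f with argmax n (f ∘ suc)
  ... | i , f≤fi with compare (f zero) (f (suc i))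
  ...   | tri< f₀<fi _ _ = suc i , λ { zero → <⇒≤ f₀<fi ; (suc j) → f≤fi j }
  ...   | tri≈ _ f₀≡fi _ = suc i , λ { zero → inj₂ f₀≡fi ; (suc j) → f≤fi j }
  ...   | tri> _ _ fi<f₀ = zero , λ { zero → ≤-refl ; (suc j) → ≤-trans (f≤fi j) (<⇒≤ fi<f₀) }

  brahmagupta : ∀ a b u v →
    (a * u + - (b * v)) * (a * u + - (b * v)) + (b * u + a * v) * (b * u + a * v) ≡ (a * a + b * b) * (u * u + v * v)
  brahmagupta a b u v = begin
    (a * u + m) * (a * u + m) + (b * u + a * v) * (b * u + a * v)
      ≡⟨ solve 5 (λ a b u v m → (a :* u :+ m) :* (a :* u :+ m) :+ (b :* u :+ a :* v) :* (b :* u :+ a :* v)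
                   := a :* a :* (u :* u :+ v :* v) :+ b :* b :* (u :* u) :+ m :* m :+ con 2 :* (a :* u) :* (m :+ b :* v))
                 refl a b u v m ⟩
    a * a * (u * u + v * v) + b * b * (u * u) + m * m + (1# + 1#) * (a * u) * (m + b * v)
      ≡⟨ cong₂ (λ m² m+bv → a * a * (u * u + v * v) + b * b * (u * u) + m² + (1# + 1#) * (a * u) * m+bv)
               (neg*neg (b * v) (b * v)) (-‿inverseˡ (b * v)) ⟩
    a * a * (u * u + v * v) + b * b * (u * u) + b * v * (b * v) + (1# + 1#) * (a * u) * 0#
      ≡⟨ solve 4 (λ a b u v → a :* a :* (u :* u :+ v :* v) :+ b :* b :* (u :* u) :+ b :* v :* (b :* v)
                              :+ con 2 :* (a :* u) :* con 0
                   := (a :* a :+ b :* b) :* (u :* u :+ v :* v))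
                 refl a b u v ⟩
    (a * a + b * b) * (u * u + v * v)  ∎
    where
    open ≡-Reasoning
    m = - (b * v)

  module PositiveEigenvector {n} (A : Matrix R (suc n)) (x : Vector R (suc n)) (ρ : Carrier)
    (A-pos : ∀ i j → 0# < A i j) (x-pos : ∀ i → 0# < x i) (Ax≡ρx : IsEigenvector (suc n) A ρ x) where

    balanced : Matrix R (suc n)
    balanced i j = x i ⁻¹ * A i j * x j

    balanced-pos : ∀ i j → 0# < balanced i j
    balanced-pos i j = *-pos (*-pos (⁻¹-pos (x-pos i)) (A-pos i j)) (x-pos j)

    balanced-nonneg : ∀ i j → 0# ≤ balanced i j
    balanced-nonneg i j = <⇒≤ (balanced-pos i j)

    weighted : Fin (suc n) → Vector R (suc n) → Carrier
    weighted i f = Σ' R (suc n) (λ j → balanced i j * f j)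

    weighted-rescale : ∀ i (w : Vector R (suc n)) → weighted i (λ j → w j * x j ⁻¹) ≡ x i ⁻¹ * mulV R (suc n) A w i
    weighted-rescale i w = begin
      Σ' R (suc n) (λ j → x i ⁻¹ * A i j * x j * (w j * x j ⁻¹))
        ≡⟨ Σ'-cong (suc n) cancel ⟩
      Σ' R (suc n) (λ j → x i ⁻¹ * (A i j * w j))
        ≡⟨ *-distribˡ-Σ' (suc n) (x i ⁻¹) (λ j → A i j * w j) ⟨
      x i ⁻¹ * mulV R (suc n) A w i  ∎
      where
      open ≡-Reasoning
      cancel : ∀ j → x i ⁻¹ * A i j * x j * (w j * x j ⁻¹) ≡ x i ⁻¹ * (A i j * w j)
      cancel j = begin
        x i ⁻¹ * A i j * x j * (w j * x j ⁻¹)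
          ≡⟨ solve 5 (λ s a xj w sj → s :* a :* xj :* (w :* sj) := s :* (a :* w) :* (xj :* sj))
                   refl (x i ⁻¹) (A i j) (x j) (w j) (x j ⁻¹) ⟩
        x i ⁻¹ * (A i j * w j) * (x j * x j ⁻¹)  ≡⟨ cong (x i ⁻¹ * (A i j * w j) *_) (⁻¹-inverseʳ (x-pos j)) ⟩
        x i ⁻¹ * (A i j * w j) * 1#              ≡⟨ *-identityʳ _ ⟩
        x i ⁻¹ * (A i j * w j)                   ∎

    balanced-rowSum : ∀ i → Σ' R (suc n) (balanced i) ≡ ρ
    balanced-rowSum i = begin
      Σ' R (suc n) (balanced i)              ≡⟨ Σ'-cong (suc n) (λ j → sym (times-one j)) ⟩
      weighted i (λ j → x j * x j ⁻¹)        ≡⟨ weighted-rescale i x ⟩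
      x i ⁻¹ * mulV R (suc n) A x i          ≡⟨ cong (x i ⁻¹ *_) (Ax≡ρx i) ⟩
      x i ⁻¹ * (ρ * x i)                     ≡⟨ solve 3 (λ s ρ x → s :* (ρ :* x) := ρ :* (s :* x)) refl _ ρ (x i) ⟩
      ρ * (x i ⁻¹ * x i)                     ≡⟨ cong (ρ *_) (⁻¹-inverseˡ (x-pos i)) ⟩
      ρ * 1#                                 ≡⟨ *-identityʳ ρ ⟩
      ρ                                      ∎
      where
      open ≡-Reasoning
      times-one : ∀ j → balanced i j * (x j * x j ⁻¹) ≡ balanced i j
      times-one j = trans (cong (balanced i j *_) (⁻¹-inverseʳ (x-pos j))) (*-identityʳ _)

    ρ-pos : 0# < ρ
    ρ-pos = subst₂ _<_ refl (balanced-rowSum zero) (Σ'-pos n (balanced-pos zero))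

    weighted-maximum : ∀ i {f : Vector R (suc n)} → (∀ j → f j ≤ f i) → weighted i f ≤ ρ * f i
    weighted-maximum i {f} f≤fᵢ = begin
      weighted i f                             ≤⟨ Σ'-mono-≤ (suc n) (λ j → *-monoˡ-≤ (balanced-nonneg i j) (f≤fᵢ j)) ⟩
      Σ' R (suc n) (λ j → balanced i j * f i)  ≡⟨ Σ'-cong (suc n) (λ j → *-comm (balanced i j) (f i)) ⟩
      Σ' R (suc n) (λ j → f i * balanced i j)  ≡⟨ *-distribˡ-Σ' (suc n) (f i) (balanced i) ⟨
      f i * Σ' R (suc n) (balanced i)          ≡⟨ trans (cong (f i *_) (balanced-rowSum i)) (*-comm (f i) ρ) ⟩
      ρ * f i                                  ∎
      where open ≤-Reasoning

    module ComplexEigenvector (a b : Carrier) (u v : Vector R (suc n))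
      (Au≡au-bv : ∀ i → mulV R (suc n) A u i ≡ a * u i + - (b * v i))
      (Av≡bu+av : ∀ i → mulV R (suc n) A v i ≡ b * u i + a * v i) where

      ũ ṽ q : Vector R (suc n)
      ũ j = u j * x j ⁻¹
      ṽ j = v j * x j ⁻¹
      q j = ũ j * ũ j + ṽ j * ṽ j

      q-pos : ∀ {k} → u k ≢ 0# ⊎ v k ≢ 0# → 0# < q k
      q-pos {k} (inj₁ uₖ≢0) = subst₂ _<_ (+-identityʳ 0#) refl
        (+-mono-<-≤ (square-pos (mul-≢0 uₖ≢0 (pos⇒≢0 (⁻¹-pos (x-pos k))))) (square-nonneg (ṽ k)))
      q-pos {k} (inj₂ vₖ≢0) = subst₂ _<_ (+-identityˡ 0#) (+-comm _ _)
        (+-mono-<-≤ (square-pos (mul-≢0 vₖ≢0 (pos⇒≢0 (⁻¹-pos (x-pos k))))) (square-nonneg (ũ k)))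

      modulus-identity : ∀ i → (a * a + b * b) * q i ≡ weighted i ũ * weighted i ũ + weighted i ṽ * weighted i ṽ
      modulus-identity i = begin
        (a * a + b * b) * ((u i * s) * (u i * s) + (v i * s) * (v i * s))
          ≡⟨ solve 5 (λ a b u v s → (a :* a :+ b :* b) :* ((u :* s) :* (u :* s) :+ (v :* s) :* (v :* s))
                                  := s :* s :* ((a :* a :+ b :* b) :* (u :* u :+ v :* v)))
                   refl a b (u i) (v i) s ⟩
        s * s * ((a * a + b * b) * (u i * u i + v i * v i))
          ≡⟨ cong (s * s *_) (brahmagupta a b (u i) (v i)) ⟨
        s * s * (X * X + Y * Y)
          ≡⟨ solve 3 (λ s X Y → s :* s :* (X :* X :+ Y :* Y) := (s :* X) :* (s :* X) :+ (s :* Y) :* (s :* Y)) refl s X Y ⟩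
        (s * X) * (s * X) + (s * Y) * (s * Y)
          ≡⟨ cong₂ (λ sX sY → sX * sX + sY * sY) (cong (s *_) (Au≡au-bv i)) (cong (s *_) (Av≡bu+av i)) ⟨
        (s * Au) * (s * Au) + (s * Av) * (s * Av)
          ≡⟨ cong₂ (λ Kũ Kṽ → Kũ * Kũ + Kṽ * Kṽ) (weighted-rescale i u) (weighted-rescale i v) ⟨
        weighted i ũ * weighted i ũ + weighted i ṽ * weighted i ṽ  ∎
        where
        open ≡-Reasoning
        s = x i ⁻¹
        X = a * u i + - (b * v i)
        Y = b * u i + a * v i
        Au = mulV R (suc n) A u i
        Av = mulV R (suc n) A v i

      cauchy-schwarz-bound : ∀ i → weighted i ũ * weighted i ũ + weighted i ṽ * weighted i ṽ ≤ ρ * weighted i q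
      cauchy-schwarz-bound i = begin
        weighted i ũ * weighted i ũ + weighted i ṽ * weighted i ṽ
          ≤⟨ +-mono-≤ (cauchy-schwarz (suc n) K ũ (balanced-nonneg i)) (cauchy-schwarz (suc n) K ṽ (balanced-nonneg i)) ⟩
        ΣK * weighted i ũ² + ΣK * weighted i ṽ²
          ≡⟨ distribˡ ΣK _ _ ⟨
        ΣK * (weighted i ũ² + weighted i ṽ²)
          ≡⟨ cong (ΣK *_) (Σ'-distrib-+ (suc n) (λ j → K j * ũ² j) (λ j → K j * ṽ² j)) ⟨
        ΣK * Σ' R (suc n) (λ j → K j * ũ² j + K j * ṽ² j)
          ≡⟨ cong₂ _*_ (balanced-rowSum i) (Σ'-cong (suc n) (λ j → sym (distribˡ (K j) (ũ² j) (ṽ² j)))) ⟩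
        ρ * weighted i q  ∎
        where
        open ≤-Reasoning
        K = balanced i
        ΣK = Σ' R (suc n) K
        ũ² ṽ² : Vector R (suc n)
        ũ² j = ũ j * ũ j
        ṽ² j = ṽ j * ṽ j

      modulus-bound : ∀ {k} → u k ≢ 0# ⊎ v k ≢ 0# → ¬ (ρ * ρ < a * a + b * b)
      modulus-bound u,v≢0 ρ²<a²+b² = ≤⇒≯ (begin
        (a * a + b * b) * q i                                      ≡⟨ modulus-identity i ⟩
        weighted i ũ * weighted i ũ + weighted i ṽ * weighted i ṽ  ≤⟨ cauchy-schwarz-bound i ⟩
        ρ * weighted i q                                           ≤⟨ *-monoˡ-≤ (<⇒≤ ρ-pos) (weighted-maximum i q≤qᵢ) ⟩
        ρ * (ρ * q i)
          ≡⟨ solve 2 (λ ρ q → ρ :* (ρ :* q) := q :* (ρ :* ρ)) refl ρ (q i) ⟩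
        q i * (ρ * ρ)                                              ∎)
        (subst₂ _<_ refl (*-comm (q i) _) (*-monoˡ-< (<-≤-trans (q-pos u,v≢0) (q≤qᵢ _)) ρ²<a²+b²))
        where
        open ≤-Reasoning
        i = proj₁ (argmax n q)
        q≤qᵢ = proj₂ (argmax n q)

    isPerronRoot : IsPerronRoot R (suc n) A ρ
    isPerronRoot = asym ρ-pos , ρ-isEigenvalue , modulus-bound
      where
      ρ-isEigenvalue : IsComplexEigenvalue R (suc n) A ρ 0#
      ρ-isEigenvalue = x , x , (zero , inj₁ (pos⇒≢0 (x-pos zero))) ,
        (λ i → trans (Ax≡ρx i) (sym (y-0x≡y (ρ * x i) (x i)))) ,
        (λ i → trans (Ax≡ρx i) (sym (0x+y≡y (ρ * x i) (x i))))
        where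
        y-0x≡y : ∀ y x → y + - (0# * x) ≡ y
        y-0x≡y y x = trans (cong (λ t → y + - t) (zeroˡ x)) (trans (cong (y +_) -0#≈0#) (+-identityʳ y))
        0x+y≡y : ∀ y x → 0# * x + y ≡ y
        0x+y≡y y x = trans (cong (_+ y) (zeroˡ x)) (+-identityˡ y)
      modulus-bound : ∀ a b → IsComplexEigenvalue R (suc n) A a b → ¬ (ρ * ρ < a * a + b * b)
      modulus-bound a b (u , v , (k , u,v≢0) , Au≡ , Av≡) = ComplexEigenvector.modulus-bound a b u v Au≡ Av≡ u,v≢0

  positiveEigenvector⇒rightPerronVector : ∀ {n} {A : Matrix R (suc n)} {x ρ} →
    (∀ i j → 0# < A i j) → (∀ i → 0# < x i) → IsEigenvector (suc n) A ρ x → IsRightPerronVector R (suc n) A x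
  positiveEigenvector⇒rightPerronVector {A = A} {x} {ρ} A-pos x-pos Ax≡ρx =
    ρ , PositiveEigenvector.isPerronRoot A x ρ A-pos x-pos Ax≡ρx , x-pos , Ax≡ρx

module Similarity (R : CompleteOrderedField) where
  open OrderedField R
  open FiniteSums R
  open Eigenvectors R

  module DiagonalSimilarity {n} (C : Matrix R n) (w y : Vector R n) (ρ : Carrier)
    (C-pc : IsPC R n C) (C-rowSum : ∀ i → Σ' R n (C i) ≡ ρ) (Cᵀw≡ρw : IsEigenvector n (transpose R n C) ρ w)
    (w-pos : ∀ i → 0# < w i) (y-pos : ∀ i → 0# < y i) where

    x z : Vector R n
    x i = w i * y i
    z i = y i ⁻¹

    x-pos : ∀ i → 0# < x i
    x-pos i = *-pos (w-pos i) (y-pos i)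

    z-pos : ∀ i → 0# < z i
    z-pos i = ⁻¹-pos (y-pos i)

    B : Matrix R n
    B i j = x i * C i j * x j ⁻¹

    B-pc : IsPC R n B
    B-pc = B-pos , B-reciprocal
      where
      C-pos = proj₁ C-pc
      B-pos : ∀ i j → 0# < B i j
      B-pos i j = *-pos (*-pos (x-pos i) (C-pos i j)) (⁻¹-pos (x-pos j))
      B-reciprocal : ∀ i j → B j i ≡ B i j ⁻¹
      B-reciprocal i j = ⁻¹-unique (B j i) (B-pos i j) (begin
        x i * C i j * x j ⁻¹ * (x j * C j i * x i ⁻¹)
          ≡⟨ solve 6 (λ xi c xj' xj c' xi' → xi :* c :* xj' :* (xj :* c' :* xi') := (xi :* xi') :* (xj :* xj') :* (c :* c'))
                   refl (x i) (C i j) (x j ⁻¹) (x j) (C j i) (x i ⁻¹) ⟩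
        (x i * x i ⁻¹) * (x j * x j ⁻¹) * (C i j * C j i)
          ≡⟨ cong₂ (λ s t → s * t * (C i j * C j i)) (⁻¹-inverseʳ (x-pos i)) (⁻¹-inverseʳ (x-pos j)) ⟩
        1# * 1# * (C i j * C j i)
          ≡⟨ cong (λ t → 1# * 1# * (C i j * t)) (proj₂ C-pc i j) ⟩
        1# * 1# * (C i j * C i j ⁻¹)
          ≡⟨ cong (1# * 1# *_) (⁻¹-inverseʳ (C-pos i j)) ⟩
        1# * 1# * 1#
          ≡⟨ solve 0 (con 1 :* con 1 :* con 1 := con 1) refl ⟩
        1#  ∎)
        where open ≡-Reasoning

    Bx≡ρx : IsEigenvector n B ρ x
    Bx≡ρx i = begin
      Σ' R n (λ j → x i * C i j * x j ⁻¹ * x j)   ≡⟨ Σ'-cong n cancel ⟩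
      Σ' R n (λ j → x i * C i j)                  ≡⟨ *-distribˡ-Σ' n (x i) (C i) ⟨
      x i * Σ' R n (C i)                          ≡⟨ cong (x i *_) (C-rowSum i) ⟩
      x i * ρ                                     ≡⟨ *-comm (x i) ρ ⟩
      ρ * x i                                     ∎
      where
      open ≡-Reasoning
      cancel : ∀ j → x i * C i j * x j ⁻¹ * x j ≡ x i * C i j
      cancel j = begin
        x i * C i j * x j ⁻¹ * x j     ≡⟨ *-assoc _ (x j ⁻¹) (x j) ⟩
        x i * C i j * (x j ⁻¹ * x j)   ≡⟨ cong (x i * C i j *_) (⁻¹-inverseˡ (x-pos j)) ⟩
        x i * C i j * 1#               ≡⟨ *-identityʳ _ ⟩
        x i * C i j                    ∎

    Bᵀz≡ρz : IsEigenvector n (transpose R n B) ρ z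
    Bᵀz≡ρz j = begin
      Σ' R n (λ i → x i * C i j * x j ⁻¹ * y i ⁻¹)   ≡⟨ Σ'-cong n cancel ⟩
      Σ' R n (λ i → x j ⁻¹ * (C i j * w i))          ≡⟨ *-distribˡ-Σ' n (x j ⁻¹) (λ i → C i j * w i) ⟨
      x j ⁻¹ * mulV R n (transpose R n C) w j        ≡⟨ cong (x j ⁻¹ *_) (Cᵀw≡ρw j) ⟩
      x j ⁻¹ * (ρ * w j)                             ≡⟨ cong (_* (ρ * w j)) (⁻¹-distrib-* (w-pos j) (y-pos j)) ⟩
      w j ⁻¹ * y j ⁻¹ * (ρ * w j)
        ≡⟨ solve 4 (λ w' y' ρ w → w' :* y' :* (ρ :* w) := ρ :* y' :* (w' :* w)) refl (w j ⁻¹) (y j ⁻¹) ρ (w j) ⟩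
      ρ * y j ⁻¹ * (w j ⁻¹ * w j)                    ≡⟨ cong (ρ * y j ⁻¹ *_) (⁻¹-inverseˡ (w-pos j)) ⟩
      ρ * y j ⁻¹ * 1#                                ≡⟨ *-identityʳ _ ⟩
      ρ * z j                                        ∎
      where
      open ≡-Reasoning
      cancel : ∀ i → x i * C i j * x j ⁻¹ * y i ⁻¹ ≡ x j ⁻¹ * (C i j * w i)
      cancel i = begin
        w i * y i * C i j * x j ⁻¹ * y i ⁻¹
          ≡⟨ solve 5 (λ w y c x' y' → w :* y :* c :* x' :* y' := x' :* (c :* w) :* (y :* y'))
                   refl (w i) (y i) (C i j) (x j ⁻¹) (y i ⁻¹) ⟩
        x j ⁻¹ * (C i j * w i) * (y i * y i ⁻¹)    ≡⟨ cong (x j ⁻¹ * (C i j * w i) *_) (⁻¹-inverseʳ (y-pos i)) ⟩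
        x j ⁻¹ * (C i j * w i) * 1#                ≡⟨ *-identityʳ _ ⟩
        x j ⁻¹ * (C i j * w i)                     ∎

    z⁻¹≡y : ∀ i → invV R n z i ≡ y i
    z⁻¹≡y i = ⁻¹-involutive (y-pos i)

chain₄ : ∀ {a ℓ} {A : Set a} {_≺_ : Rel A ℓ} → Transitive _≺_ → (f : Fin 4 → A) →
  f 0F ≺ f 1F → f 1F ≺ f 2F → f 2F ≺ f 3F → ∀ {i j} → i Fin.< j → f i ≺ f j
chain₄ {_≺_ = _≺_} ≺-trans f f₀≺f₁ f₁≺f₂ f₂≺f₃ = go
  where
  go : ∀ {i j} → i Fin.< j → f i ≺ f j
  go {_}  {0F} ()
  go {0F} {1F} _ = f₀≺f₁
  go {suc _} {1F} (ℕ.s≤s ())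
  go {0F} {2F} _ = ≺-trans f₀≺f₁ f₁≺f₂
  go {1F} {2F} _ = f₁≺f₂
  go {suc (suc _)} {2F} (ℕ.s≤s (ℕ.s≤s ()))
  go {0F} {3F} _ = ≺-trans f₀≺f₁ (≺-trans f₁≺f₂ f₂≺f₃)
  go {1F} {3F} _ = ≺-trans f₁≺f₂ f₂≺f₃
  go {2F} {3F} _ = f₂≺f₃
  go {3F} {3F} (ℕ.s≤s (ℕ.s≤s (ℕ.s≤s ())))

module Orders (R : CompleteOrderedField) where
  open OrderedField R

  strictlyReverse : ∀ {n} {x y : Vector R n} → (∀ {i j} → i Fin.< j → x i < x j) → (∀ {i j} → i Fin.< j → y j < y i) →
    StrictlyReverse R n x y
  strictlyReverse x↑ y↓ i j i≢j with Fin.<-cmp i j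
  ... | tri< i<j _ _ = inj₁ (x↑ i<j , y↓ i<j)
  ... | tri≈ _ i≡j _ = ⊥-elim (i≢j i≡j)
  ... | tri> _ _ j<i = inj₂ (x↑ j<i , y↓ j<i)

  increasingAlong4 : ∀ σ (f g : Vector R 4) → (∀ k → f (σ ⟨$⟩ʳ k) ≡ g k) →
    g 0F < g 1F → g 1F < g 2F → g 2F < g 3F → IncreasingAlong4 R σ f
  increasingAlong4 σ f g f∘σ≡g g₀<g₁ g₁<g₂ g₂<g₃ =
    step g₀<g₁ , step g₁<g₂ , step g₂<g₃
    where
    step : ∀ {k l} → g k < g l → f (σ ⟨$⟩ʳ k) < f (σ ⟨$⟩ʳ l)
    step = subst₂ _<_ (sym (f∘σ≡g _)) (sym (f∘σ≡g _))

  reverse-orders : ∀ {x y : Vector R 4} → IncreasingAlong4 R Permutation.id x → IncreasingAlong4 R Permutation.reverse y →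
    StrictlyReverse R 4 x y
  reverse-orders {x} {y} (x₀<x₁ , x₁<x₂ , x₂<x₃) (y₃<y₂ , y₂<y₁ , y₁<y₀) = strictlyReverse
    (chain₄ {_≺_ = _<_} <-trans x x₀<x₁ x₁<x₂ x₂<x₃)
    (chain₄ {_≺_ = λ a b → b < a} (λ b<a c<b → <-trans c<b b<a) y y₁<y₀ y₂<y₁ y₃<y₂)

module Example (R : CompleteOrderedField) where
  open OrderedField R
  open FiniteSums R
  open Eigenvectors R
  open PerronRoot R using (positiveEigenvector⇒rightPerronVector)
  open Similarity R using (module DiagonalSimilarity)
  open Orders R using (increasingAlong4)

  entries : Fin 4 → Fin 4 → ℕ
  entries i j = lookup (lookup rows i) j
    where
    rows : Vec (Vec ℕ 4) 4
    rows = (84  ∷ 147 ∷ 63  ∷ 126 ∷ []) ∷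
           (48  ∷ 84  ∷ 36  ∷ 252 ∷ []) ∷
           (112 ∷ 196 ∷ 84  ∷ 28  ∷ []) ∷
           (56  ∷ 28  ∷ 252 ∷ 84  ∷ []) ∷ []

  weights : Fin 4 → ℕ
  weights = lookup (52 ∷ 77 ∷ 81 ∷ 84 ∷ [])

  entries-reciprocal : ∀ i j → entries i j ℕ.* entries j i ≡ 84 ℕ.* 84
  entries-reciprocal = λ { 0F 0F → refl ; 0F 1F → refl ; 0F 2F → refl ; 0F 3F → refl
                         ; 1F 0F → refl ; 1F 1F → refl ; 1F 2F → refl ; 1F 3F → refl
                         ; 2F 0F → refl ; 2F 1F → refl ; 2F 2F → refl ; 2F 3F → refl
                         ; 3F 0F → refl ; 3F 1F → refl ; 3F 2F → refl ; 3F 3F → refl }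

  entries-rowSum : ∀ i → sumℕ (entries i) ≡ 420
  entries-rowSum = λ { 0F → refl ; 1F → refl ; 2F → refl ; 3F → refl }

  weights-leftEigenvector : ∀ j → sumℕ (λ i → entries i j ℕ.* weights i) ≡ 420 ℕ.* weights j
  weights-leftEigenvector = λ { 0F → refl ; 1F → refl ; 2F → refl ; 3F → refl }

  entries-pos : ∀ i j → 0 ℕ.< entries i j
  entries-pos i j = ℕ.n≢0⇒n>0 λ eᵢⱼ≡0 →
    ℕ.0≢1+n (trans (cong (ℕ._* entries j i) (sym eᵢⱼ≡0)) (entries-reciprocal i j))

  weights-pos : ∀ i → 0 ℕ.< weights i
  weights-pos = λ { 0F → ℕ.z<s ; 1F → ℕ.z<s ; 2F → ℕ.z<s ; 3F → ℕ.z<s }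

  ε : Carrier
  ε = fromℕ 84 ⁻¹

  84ε≡1 : fromℕ 84 * ε ≡ 1#
  84ε≡1 = ⁻¹-inverseʳ (fromℕ-< {0} {84} ℕ.z<s)

  C : Matrix R 4
  C i j = ε * fromℕ (entries i j)

  ρ : Carrier
  ρ = ε * fromℕ 420

  C-pc : IsPC R 4 C
  C-pc = C-pos , C-reciprocal
    where
    C-pos : ∀ i j → 0# < C i j
    C-pos i j = *-pos (⁻¹-pos (fromℕ-< {0} {84} ℕ.z<s)) (fromℕ-< (entries-pos i j))
    C-reciprocal : ∀ i j → C j i ≡ C i j ⁻¹
    C-reciprocal i j = ⁻¹-unique (C j i) (C-pos i j) (begin
      ε * fromℕ (entries i j) * (ε * fromℕ (entries j i))
        ≡⟨ solve 3 (λ ε e e' → ε :* e :* (ε :* e') := ε :* ε :* (e :* e')) refl ε _ _ ⟩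
      ε * ε * (fromℕ (entries i j) * fromℕ (entries j i))
        ≡⟨ cong (ε * ε *_) (×1-homo-* (entries i j) (entries j i)) ⟨
      ε * ε * fromℕ (entries i j ℕ.* entries j i)
        ≡⟨ cong (λ e → ε * ε * fromℕ e) (entries-reciprocal i j) ⟩
      ε * ε * fromℕ (84 ℕ.* 84)
        ≡⟨ cong (ε * ε *_) (×1-homo-* 84 84) ⟩
      ε * ε * (fromℕ 84 * fromℕ 84)
        ≡⟨ solve 2 (λ ε d → ε :* ε :* (d :* d) := (d :* ε) :* (d :* ε)) refl ε (fromℕ 84) ⟩
      (fromℕ 84 * ε) * (fromℕ 84 * ε)
        ≡⟨ cong₂ _*_ 84ε≡1 84ε≡1 ⟩
      1# * 1#
        ≡⟨ *-identityˡ 1# ⟩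
      1#  ∎)
      where open ≡-Reasoning

  C-rowSum : ∀ i → Σ' R 4 (C i) ≡ ρ
  C-rowSum i = begin
    Σ' R 4 (λ j → ε * fromℕ (entries i j))   ≡⟨ *-distribˡ-Σ' 4 ε (fromℕ ∘ entries i) ⟨
    ε * Σ' R 4 (fromℕ ∘ entries i)           ≡⟨ cong (ε *_) (Σ'-fromℕ 4 (entries i)) ⟩
    ε * fromℕ (sumℕ (entries i))             ≡⟨ cong (λ r → ε * fromℕ r) (entries-rowSum i) ⟩
    ρ                                        ∎
    where open ≡-Reasoning

  Cᵀw≡ρw : IsEigenvector 4 (transpose R 4 C) ρ (fromℕ ∘ weights)
  Cᵀw≡ρw j = begin
    Σ' R 4 (λ i → ε * fromℕ (entries i j) * fromℕ (weights i))
      ≡⟨ Σ'-cong 4 (λ i → trans (*-assoc ε _ _) (cong (ε *_) (sym (×1-homo-* (entries i j) (weights i))))) ⟩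
    Σ' R 4 (λ i → ε * fromℕ (entries i j ℕ.* weights i))
      ≡⟨ *-distribˡ-Σ' 4 ε (λ i → fromℕ (entries i j ℕ.* weights i)) ⟨
    ε * Σ' R 4 (λ i → fromℕ (entries i j ℕ.* weights i))
      ≡⟨ cong (ε *_) (trans (Σ'-fromℕ 4 (λ i → entries i j ℕ.* weights i)) (cong fromℕ (weights-leftEigenvector j))) ⟩
    ε * fromℕ (420 ℕ.* weights j)
      ≡⟨ trans (cong (ε *_) (×1-homo-* 420 (weights j))) (sym (*-assoc ε _ _)) ⟩
    ρ * fromℕ (weights j)  ∎
    where open ≡-Reasoning

  level : Fin 4 → ℕ
  level t = 100 ℕ.+ toℕ t

  weights-gap : ∀ (k : Fin 3) → weights (Fin.inject₁ k) ℕ.* 103 ℕ.< weights (suc k) ℕ.* 100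
  weights-gap = λ { 0F → ℕ.<ᵇ⇒< _ _ _ ; 1F → ℕ.<ᵇ⇒< _ _ _ ; 2F → ℕ.<ᵇ⇒< _ _ _ }

  weights-level-< : ∀ (k : Fin 3) (s t : Fin 4) →
    fromℕ (weights (Fin.inject₁ k)) * fromℕ (level s) < fromℕ (weights (suc k)) * fromℕ (level t)
  weights-level-< k s t = subst₂ _<_ (×1-homo-* a (level s)) (×1-homo-* b (level t)) (fromℕ-< (begin-strict
    a ℕ.* level s      ≤⟨ ℕ.*-monoʳ-≤ a (ℕ.+-monoʳ-≤ 100 (Fin.toℕ≤pred[n] s)) ⟩
    a ℕ.* 103          <⟨ weights-gap k ⟩
    b ℕ.* 100          ≤⟨ ℕ.*-monoʳ-≤ b (ℕ.m≤m+n 100 (toℕ t)) ⟩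
    b ℕ.* level t      ∎))
    where
    open ℕ.≤-Reasoning
    a = weights (Fin.inject₁ k)
    b = weights (suc k)

  module Construction (σ τ : Permutation′ 4) where
    σ⁻¹ : Permutation′ 4
    σ⁻¹ = Permutation.flip σ

    C′ : Matrix R 4
    C′ = permute σ⁻¹ C

    C′-rowSum : ∀ i → Σ' R 4 (C′ i) ≡ ρ
    C′-rowSum i = trans (permute-rowSum σ⁻¹ C i) (C-rowSum (σ⁻¹ ⟨$⟩ʳ i))

    w y : Vector R 4
    w = fromℕ ∘ weights ∘ (σ⁻¹ ⟨$⟩ʳ_)
    y i = fromℕ (level (τ ⟨$⟩ˡ i))

    w-pos : ∀ i → 0# < w i
    w-pos i = fromℕ-< (weights-pos (σ⁻¹ ⟨$⟩ʳ i))

    y-pos : ∀ i → 0# < y i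
    y-pos i = fromℕ-< {0} {level (τ ⟨$⟩ˡ i)} ℕ.z<s

    open DiagonalSimilarity C′ w y ρ
      (permute-pc σ⁻¹ C-pc) C′-rowSum (permute-eigenvector σ⁻¹ {transpose R 4 C} Cᵀw≡ρw) w-pos y-pos
      public

    x-increasing : IncreasingAlong4 R σ x
    x-increasing = increasingAlong4 σ x (λ k → fromℕ (weights k) * fromℕ (level (t k)))
      (λ k → cong (λ i → fromℕ (weights i) * y (σ ⟨$⟩ʳ k)) (Permutation.inverseˡ σ))
      (weights-level-< 0F (t 0F) (t 1F)) (weights-level-< 1F (t 1F) (t 2F)) (weights-level-< 2F (t 2F) (t 3F))
      where
      t : Fin 4 → Fin 4
      t k = τ ⟨$⟩ˡ (σ ⟨$⟩ʳ k)

    right : IsRightPerronVector R 4 B x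
    right = positiveEigenvector⇒rightPerronVector (proj₁ B-pc) x-pos Bx≡ρx

    left : IsLeftPerronVector R 4 B z
    left = positiveEigenvector⇒rightPerronVector (λ i j → proj₁ B-pc j i) z-pos Bᵀz≡ρz

    z⁻¹-increasing : IncreasingAlong4 R τ (invV R 4 z)
    z⁻¹-increasing = increasingAlong4 τ (invV R 4 z) (fromℕ ∘ level)
      (λ k → trans (z⁻¹≡y _) (cong (fromℕ ∘ level) (Permutation.inverseˡ τ)))
      (fromℕ-<-suc 100) (fromℕ-<-suc 101) (fromℕ-<-suc 102)

mainTheorem2 : (R : CompleteOrderedField) →
    ((σ τ : Permutation′ 4) →
      ∃[ B ] (IsPC R 4 B × ∃[ x ] ∃[ z ] (IsRightPerronVector R 4 B x ×
        IsLeftPerronVector R 4 B z × IncreasingAlong4 R σ x ×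
        IncreasingAlong4 R τ (invV R 4 z)))) ×
    (∃[ B ] (IsPC R 4 B × ∃[ x ] ∃[ z ] (IsRightPerronVector R 4 B x ×
        IsLeftPerronVector R 4 B z × StrictlyReverse R 4 x (invV R 4 z))))
mainTheorem2 R =
  (λ σ τ → let open Construction σ τ in
    B , B-pc , x , z , right , left , x-increasing , z⁻¹-increasing) ,
  (let open Construction Permutation.id Permutation.reverse in
    B , B-pc , x , z , right , left , reverse-orders x-increasing z⁻¹-increasing)
  where
  open Example R
  open Orders R
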